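{- Let $\mathcal{F}$ be a filter on a semigroup $G$. For $n\ge0$, an $n$-recurrent set $A\subseteq G$ and a set $D\subseteq G$: $D$ is recurrently $n$-thick in $A$ if and only if $A\cap D$ is $n$-recurrent.
   Context: A filter $\mathcal{F}$ on $G$: nonempty family of subsets not containing $\emptyset$, closed upward and under finite intersections; $\mathcal{F}$-small means the complement is in $\mathcal{F}$; $\mathcal{F}$-positive means not $\mathcal{F}$-small. "$\exists^\mathcal{F} g\in G\, P(g)$" means $\{g : P(g)\}$ is $\mathcal{F}$-positive. $Ag^{ -1}:=\{h : hg\in A\}$, $\partial_gA := A\cap Ag^{ -1}$. Recurrence: $A$ is $0$-recurrent if $\mathcal{F}$-positive; for $n\ge1$, $\Delta^n(A) := \{g : \partial_gA \text{ is } (n-1)\text{ -recurrent}\}$ and $A$ is $n$-recurrent if $\Delta^n(A)$ is $\mathcal{F}$-positive. Recurrent thickness: $D$ is recurrently $0$-thick in $A$ if either $A$ is $\mathcal{F}$-small or $A\cap D$ is $\mathcal{F}$-positive; for $n\ge1$, $D$ is recurrently $n$-thick in $A$ if either $A$ is not $n$-recurrent, or $\exists^\mathcal{F} g\in G$ such that $\partial_gA$ is $(n-1)$-recurrent and $\partial_g D$ is recurrently $(n-1)$-thick in $\partial_g A$. -}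

module Defs where

open import Level using (Level; _⊔_; Lift)
open import Data.Empty using (⊥)
open import Data.Nat using (ℕ; zero; suc)
open import Data.Product using (Σ; _×_)
open import Data.Sum using (_⊎_)
open import Relation.Nullary using (¬_)
open import Relation.Unary using (Pred; _⊆_; _∩_; ∁; ∅)
open import Algebra.Bundles using (Semigroup)

record Filter {c : Level} (G : Set c) (ℓ : Level) : Set (c ⊔ Level.suc ℓ) where
  field
    F          : Pred (Pred G ℓ) ℓ
    nonempty   : Σ (Pred G ℓ) F
    no-empty   : ¬ F (λ _ → Lift ℓ ⊥)
    upward     : ∀ {X Y : Pred G ℓ} → X ⊆ Y → F X → F Y
    intersect  : ∀ {X Y : Pred G ℓ} → F X → F Y → F (X ∩ Y)

module _ {c ℓ≈ ℓ : Level} (S : Semigroup c ℓ≈) (𝓕 : Filter (Semigroup.Carrier S) ℓ) where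
  open Semigroup S using (Carrier; _∙_)
  open Filter 𝓕 using (F)

  Small : Pred Carrier ℓ → Set ℓ
  Small A = F (∁ A)

  Positive : Pred Carrier ℓ → Set ℓ
  Positive A = ¬ Small A

  _·_⁻¹ : Pred Carrier ℓ → Carrier → Pred Carrier ℓ
  (A · g ⁻¹) h = A (h ∙ g)

  ∂ : Carrier → Pred Carrier ℓ → Pred Carrier ℓ
  ∂ g A = A ∩ (A · g ⁻¹)

  Recurrent : ℕ → Pred Carrier ℓ → Set ℓ
  Δ : ℕ → Pred Carrier ℓ → Pred Carrier ℓ
  Recurrent zero A = Positive A
  Recurrent (suc n) A = Positive (Δ (suc n) A)
  Δ zero A = A   -- unused convention; Δ^n is only defined for n ≥ 1
  Δ (suc n) A g = Recurrent n (∂ g A)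

  RecThick : ℕ → Pred Carrier ℓ → Pred Carrier ℓ → Set ℓ
  RecThick zero A D = Small A ⊎ Positive (A ∩ D)
  RecThick (suc n) A D =
    ¬ Recurrent (suc n) A
    ⊎ Positive (λ g → Recurrent n (∂ g A) × RecThick n (∂ g A) (∂ g D))

module Submission where

-- Both notions are defined by recursion on n through the sets ∂_g A = A ∩ A g⁻¹,
-- so the theorem is proved by induction on n using three structural facts:
--   * 𝓕-positivity, and hence n-recurrence, is monotone under inclusion;
--   * ∂_g is monotone and commutes with intersection: ∂_g (A ∩ D) = ∂_g A ∩ ∂_g D.
-- At level n+1, a witness g for "∂_g D is recurrently n-thick in the n-recurrent
-- set ∂_g A" is, by the induction hypothesis, exactly a g with ∂_g A ∩ ∂_g D,
-- i.e. ∂_g (A ∩ D), n-recurrent; so the two 𝓕-positive sets of witnesses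
-- contain each other.  The direction "A ∩ D recurrent ⇒ D thick in A" holds for
-- every A; only the converse uses that A itself is n-recurrent, to rule out the
-- degenerate first alternative in the definition of recurrent thickness.

open import Defs
open import Level using (Level)
open import Data.Nat using (ℕ; zero; suc)
open import Data.Product using (_×_; _,_; proj₁; proj₂)
open import Data.Sum using (inj₁; inj₂)
open import Data.Empty using (⊥-elim)
open import Relation.Unary using (Pred; _∩_; _⊆_)
open import Algebra.Bundles using (Semigroup)

module Recurrence {c ℓ≈ ℓ : Level} (S : Semigroup c ℓ≈) (𝓕 : Filter (Semigroup.Carrier S) ℓ) where
  open Semigroup S using (Carrier; _∙_)
  open Filter 𝓕 using (upward)

  private
    Subset : Set _
    Subset = Pred Carrier ℓ

  positive-mono : {A B : Subset} → A ⊆ B → Positive S 𝓕 A → Positive S 𝓕 B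
  positive-mono A⊆B posA smallB = posA (upward (λ notB a → notB (A⊆B a)) smallB)

  ∂-mono : ∀ g {A B : Subset} → A ⊆ B → ∂ S 𝓕 g A ⊆ ∂ S 𝓕 g B
  ∂-mono g {A} {B} A⊆B {h} (a , ag) = A⊆B {h} a , A⊆B {h ∙ g} ag

  recurrent-mono : ∀ n {A B : Subset} → A ⊆ B → Recurrent S 𝓕 n A → Recurrent S 𝓕 n B
  recurrent-mono zero    A⊆B = positive-mono A⊆B
  recurrent-mono (suc n) A⊆B =
    positive-mono (λ {g} → recurrent-mono n (∂-mono g (λ {h} → A⊆B {h})))

  ∂-∩-⊆ : ∀ g (A D : Subset) → ∂ S 𝓕 g (A ∩ D) ⊆ ∂ S 𝓕 g A ∩ ∂ S 𝓕 g D
  ∂-∩-⊆ g A D ((a , d) , (ag , dg)) = (a , ag) , (d , dg)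

  ∂-∩-⊇ : ∀ g (A D : Subset) → ∂ S 𝓕 g A ∩ ∂ S 𝓕 g D ⊆ ∂ S 𝓕 g (A ∩ D)
  ∂-∩-⊇ g A D ((a , ag) , (d , dg)) = (a , d) , (ag , dg)

  recurrent⇒thick : ∀ n (A D : Subset) →
                    Recurrent S 𝓕 n (A ∩ D) → RecThick S 𝓕 n A D
  recurrent⇒thick zero    A D posA∩D = inj₂ posA∩D
  recurrent⇒thick (suc n) A D recA∩D = inj₂ (positive-mono witness recA∩D)
    where
    witness : ∀ {g} → Recurrent S 𝓕 n (∂ S 𝓕 g (A ∩ D)) →
              Recurrent S 𝓕 n (∂ S 𝓕 g A) × RecThick S 𝓕 n (∂ S 𝓕 g A) (∂ S 𝓕 g D)
    witness {g} rec∂ =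
      recurrent-mono n (λ {h} x → proj₁ (∂-∩-⊆ g A D {h} x)) rec∂ ,
      recurrent⇒thick n (∂ S 𝓕 g A) (∂ S 𝓕 g D) (recurrent-mono n (∂-∩-⊆ g A D) rec∂)

  thick⇒recurrent : ∀ n (A D : Subset) → Recurrent S 𝓕 n A →
                    RecThick S 𝓕 n A D → Recurrent S 𝓕 n (A ∩ D)
  thick⇒recurrent zero    A D posA (inj₁ smallA) = ⊥-elim (posA smallA)
  thick⇒recurrent zero    A D posA (inj₂ posA∩D) = posA∩D
  thick⇒recurrent (suc n) A D recA (inj₁ notRecA) = ⊥-elim (notRecA recA)
  thick⇒recurrent (suc n) A D recA (inj₂ thick)   = positive-mono witness thick
    where
    witness : ∀ {g} →
              Recurrent S 𝓕 n (∂ S 𝓕 g A) × RecThick S 𝓕 n (∂ S 𝓕 g A) (∂ S 𝓕 g D) →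
              Recurrent S 𝓕 n (∂ S 𝓕 g (A ∩ D))
    witness {g} (rec∂A , thick∂) =
      recurrent-mono n (∂-∩-⊇ g A D)
        (thick⇒recurrent n (∂ S 𝓕 g A) (∂ S 𝓕 g D) rec∂A thick∂)

mainTheorem6 : {c ℓ≈ ℓ : Level} (S : Semigroup c ℓ≈) (𝓕 : Filter (Semigroup.Carrier S) ℓ)
    (n : ℕ) (A D : Pred (Semigroup.Carrier S) ℓ) →
    Recurrent S 𝓕 n A →
    (RecThick S 𝓕 n A D → Recurrent S 𝓕 n (A ∩ D))
    × (Recurrent S 𝓕 n (A ∩ D) → RecThick S 𝓕 n A D)
mainTheorem6 S 𝓕 n A D recA =
  Recurrence.thick⇒recurrent S 𝓕 n A D recA , Recurrence.recurrent⇒thick S 𝓕 n A D
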